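{- $\chi_{la}(C_8(1,2,3))=\chi(C_8(1,2,3))=4$.
   Context: The circulant graph $C_n(1,a_1,\dots,a_t)$ has vertex set $\mathbb{Z}_n$, with $i$ and $j$ adjacent iff their cyclic distance $\min(|i-j|, n-|i-j|)$ lies in $\{1,a_1,\dots,a_t\}$. $\chi$ is the chromatic number. For a simple graph $G=(V,E)$ with $q$ edges, a bijection $f:E\to\{1,\dots,q\}$ is a local antimagic labeling if $f^+(u)\neq f^+(v)$ for every edge $uv$, where $f^+(u)=\sum_{e\ni u} f(e)$. The local antimagic chromatic number $\chi_{la}(G)$ is the minimum number of distinct values of $f^+$ over all local antimagic labelings $f$ of $G$. -}

module Defs where

open import Data.Nat as ℕ using (ℕ; zero; suc; _⊓_; _∸_; ∣_-_∣; _≡ᵇ_; _≤_)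
open import Data.Nat.Properties using () renaming (_≟_ to _≟ℕ_)
open import Data.Fin as Fin using (Fin; toℕ)
open import Data.Fin.Properties using (<-cmp)
open import Data.Bool using (Bool; true; false)
open import Data.List using (List; _∷_; []; map; length; deduplicate)
open import Data.Bool.ListAction using (any)
open import Data.Nat.ListAction using (sum)
open import Data.List using () renaming (allFin to allFinL)
open import Data.Product using (Σ; _×_; _,_; proj₁; proj₂; ∃)
open import Function.Bundles using (_⤖_; Bijection)
open import Relation.Binary.PropositionalEquality using (_≡_; _≢_)
open import Relation.Binary.Definitions using (tri<; tri≈; tri>)

-- Only the entries adj i j with i < j are used (edges are unordered pairs
-- {i,j}, i ≠ j, represented with i < j); loops are impossible by construction.
record Graph (n : ℕ) : Set where
  field adj : Fin n → Fin n → Bool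
open Graph public

Edge : ∀ {n} → Graph n → Set
Edge {n} G = Σ (Fin n × Fin n) λ p → (proj₁ p Fin.< proj₂ p) × (adj G (proj₁ p) (proj₂ p) ≡ true)

cycDist : (n : ℕ) → Fin n → Fin n → ℕ
cycDist n i j = ∣ toℕ i - toℕ j ∣ ⊓ (n ∸ ∣ toℕ i - toℕ j ∣)

circulant : (n : ℕ) → List ℕ → Graph n
circulant n S = record { adj = λ i j → any (λ s → s ≡ᵇ cycDist n i j) S }

ProperColoring : ∀ {n} → Graph n → (k : ℕ) → (Fin n → Fin k) → Set
ProperColoring G k c = (e : Edge G) → c (proj₁ (proj₁ e)) ≢ c (proj₂ (proj₁ e))

IsChromaticNumber : ∀ {n} → Graph n → ℕ → Set
IsChromaticNumber {n} G k =
  (Σ (Fin n → Fin k) (ProperColoring G k)) ×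
  (∀ m (c : Fin n → Fin m) → ProperColoring G m c → k ≤ m)

-- An edge labeling with labels 1..q: a bijection E ⤖ Fin q; edge e gets label
-- 1 + toℕ (f e).
EdgeLabeling : ∀ {n} → Graph n → ℕ → Set
EdgeLabeling G q = Edge G ⤖ Fin q

label : ∀ {n} {G : Graph n} {q} → EdgeLabeling G q → Edge G → ℕ
label f e = suc (toℕ (Bijection.to f e))

weight : ∀ {n} (G : Graph n) → (Edge G → ℕ) → Fin n → Fin n → ℕ
weight G ℓ u v with <-cmp u v
... | tri< u<v _ _ with adj G u v in eq
...   | true  = ℓ ((u , v) , u<v , eq)
...   | false = 0
weight G ℓ u v | tri> _ _ v<u with adj G v u in eq
...   | true  = ℓ ((v , u) , v<u , eq)
...   | false = 0
weight G ℓ u v | tri≈ _ _ _ = 0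

vertexSum : ∀ {n} {G : Graph n} {q} → EdgeLabeling G q → Fin n → ℕ
vertexSum {n} {G} f u = sum (map (weight G (label f) u) (allFinL n))

IsLocalAntimagic : ∀ {n} {G : Graph n} {q} → EdgeLabeling G q → Set
IsLocalAntimagic {G = G} f =
  (e : Edge G) → vertexSum f (proj₁ (proj₁ e)) ≢ vertexSum f (proj₂ (proj₁ e))

numColors : ∀ {n} {G : Graph n} {q} → EdgeLabeling G q → ℕ
numColors {n} f = length (deduplicate _≟ℕ_ (map (vertexSum f) (allFinL n)))

-- χ_la(G) = k : minimum of numColors over local antimagic labelings is k.
-- (q ranges over all naturals; a bijection E ⤖ Fin q forces q = |E|.)
IsLocalAntimagicChromaticNumber : ∀ {n} → Graph n → ℕ → Set
IsLocalAntimagicChromaticNumber G k =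
  (∃ λ q → Σ (EdgeLabeling G q) λ f → IsLocalAntimagic f × numColors f ≡ k) ×
  (∀ q (f : EdgeLabeling G q) → IsLocalAntimagic f → k ≤ numColors f)

{-# OPTIONS --safe #-}
-- The vertices 0, 1, 2, 3 are pairwise at cyclic distance at most 3, so they form a
-- 4-clique and every proper colouring needs 4 colours. The vertex sums of a local
-- antimagic labeling are themselves a proper colouring (colour a vertex by the position
-- of its sum among the distinct sums), so χ ≤ χ_la and the clique bounds both numbers.
-- The colouring i ↦ i mod 4 and an explicit labeling with vertex sums 69, 72, 78, 81
-- (repeating with period 4) attain 4; these finite facts are checked by evaluating
-- decision procedures.
module Submission where

open import Defs
open import Data.Nat using (ℕ; _≤_)
open import Data.Nat.DivMod using (_mod_)
import Data.Nat.Properties as ℕ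
open import Data.Bool using (true)
import Data.Bool.Properties as Bool
open import Data.Fin using (Fin; _<_; toℕ; _↑ˡ_; #_)
open import Data.Fin.Patterns
open import Data.Fin.Properties using (_<?_; <-cmp; <-irrelevant; all?; any?; injective⇒≤) renaming (_≟_ to _≟ᶠ_)
open import Data.List using (List; _∷_; []; map; length; lookup; deduplicate; allFin)
import Data.List.Relation.Unary.Any as Any
open import Data.List.Relation.Unary.Any.Properties using (lookup-index)
open import Data.List.Membership.Propositional using (_∈_)
open import Data.List.Membership.Propositional.Properties using (∈-map⁺; ∈-allFin; ∈-deduplicate⁺)
open import Data.Product using (Σ; _×_; _,_; proj₁; proj₂)
open import Data.Product.Properties using (≡-dec)
open import Function using (_∘_)
open import Function.Bundles using (_⤖_; mk⤖)
open import Function.Definitions using (Injective; Surjective)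
open import Relation.Binary.Definitions using (Decidable; tri<; tri≈; tri>)
open import Relation.Binary.PropositionalEquality using (_≡_; _≢_; refl; sym; cong; cong₂; module ≡-Reasoning)
open import Relation.Nullary using (Dec; ¬?; contradiction)
open import Relation.Nullary.Decidable using (_×-dec_; _→-dec_; map′; from-yes)
open import Axiom.UniquenessOfIdentityProofs using (module Decidable⇒UIP)

module _ {n : ℕ} {G : Graph n} where

  src tgt : Edge G → Fin n
  src = proj₁ ∘ proj₁
  tgt = proj₂ ∘ proj₁

  endpoints-injective : {e e′ : Edge G} → proj₁ e ≡ proj₁ e′ → e ≡ e′
  endpoints-injective {_ , i<j , a} {_ , i<j′ , a′} refl =
    cong (_ ,_) (cong₂ _,_ (<-irrelevant i<j i<j′) (Decidable⇒UIP.≡-irrelevant Bool._≟_ a a′))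

Edgewise : ∀ {n} → Graph n → (Fin n → Fin n → Set) → Set
Edgewise G P = ∀ i j → i < j → adj G i j ≡ true → P i j

module _ {n : ℕ} (G : Graph n) {P : Fin n → Fin n → Set} (P? : Decidable P) where

  edgewise? : Dec (Edgewise G P)
  edgewise? = all? λ i → all? λ j → (i <? j) →-dec (adj G i j Bool.≟ true) →-dec P? i j

  someEdge? : Dec (Σ (Edge G) λ e → P (src e) (tgt e))
  someEdge? = map′ (λ (i , j , e , p) → ((i , j) , e) , p) (λ (((i , j) , e) , p) → i , j , e , p)
    (any? λ i → any? λ j → ((i <? j) ×-dec (adj G i j Bool.≟ true)) ×-dec P? i j)

edgewise⇒∀ : ∀ {n} {G : Graph n} {P : Fin n → Fin n → Set} →
  Edgewise G P → (e : Edge G) → P (src e) (tgt e)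
edgewise⇒∀ all (_ , i<j , a) = all _ _ i<j a

edgeBijection : ∀ {n q} {G : Graph n} (code : Fin n → Fin n → Fin q) →
  Edgewise G (λ i j → Edgewise G λ i′ j′ → code i j ≡ code i′ j′ → (i , j) ≡ (i′ , j′)) →
  (∀ k → Σ (Edge G) λ e → code (src e) (tgt e) ≡ k) →
  Edge G ⤖ Fin q
edgeBijection code injective surjective = mk⤖ {to = code′} (injective′ , surjective′)
  where
  code′ : Edge _ → Fin _
  code′ e = code (src e) (tgt e)
  injective′ : Injective _≡_ _≡_ code′
  injective′ {e} {e′} = endpoints-injective ∘ edgewise⇒∀ (edgewise⇒∀ injective e) e′
  surjective′ : Surjective _≡_ _≡_ code′
  surjective′ k = proj₁ (surjective k) , λ { refl → proj₂ (surjective k) }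

module _ {n : ℕ} {G : Graph n} where

  IsClique : ∀ {k} → (Fin k → Fin n) → Set
  IsClique vs = ∀ a b → a < b → vs a < vs b × adj G (vs a) (vs b) ≡ true

  clique⇒χ-bound : ∀ {k m} {vs : Fin k → Fin n} {c : Fin n → Fin m} →
    IsClique vs → ProperColoring G m c → k ≤ m
  clique⇒χ-bound {vs = vs} {c} clique proper = injective⇒≤ c∘vs-injective
    where
    adjacent : ∀ {a b} → a < b → c (vs a) ≢ c (vs b)
    adjacent a<b = let vs-a<vs-b , a = clique _ _ a<b in proper (_ , vs-a<vs-b , a)
    c∘vs-injective : Injective _≡_ _≡_ (c ∘ vs)
    c∘vs-injective {a} {b} eq with <-cmp a b
    ... | tri< a<b _ _ = contradiction eq (adjacent a<b)
    ... | tri≈ _ a≡b _ = a≡b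
    ... | tri> _ _ b<a = contradiction (sym eq) (adjacent b<a)

  distinctValues : (Fin n → ℕ) → List ℕ
  distinctValues g = deduplicate ℕ._≟_ (map g (allFin n))

  value∈distinctValues : ∀ g u → g u ∈ distinctValues g
  value∈distinctValues g u = ∈-deduplicate⁺ ℕ._≟_ (∈-map⁺ g (∈-allFin u))

  valueClass : (g : Fin n → ℕ) → Fin n → Fin (length (distinctValues g))
  valueClass g = Any.index ∘ value∈distinctValues g

  valueClass-sound : ∀ g {u v} → valueClass g u ≡ valueClass g v → g u ≡ g v
  valueClass-sound g {u} {v} eq = begin
    g u                                      ≡⟨ lookup-index (value∈distinctValues g u) ⟩
    lookup (distinctValues g) (valueClass g u) ≡⟨ cong (lookup (distinctValues g)) eq ⟩
    lookup (distinctValues g) (valueClass g v) ≡⟨ lookup-index (value∈distinctValues g v) ⟨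
    g v                                      ∎
    where open ≡-Reasoning

  localAntimagic⇒proper : ∀ {q} {f : EdgeLabeling G q} →
    IsLocalAntimagic f → ProperColoring G (numColors f) (valueClass (vertexSum f))
  localAntimagic⇒proper antimagic e = antimagic e ∘ valueClass-sound _

  χ-bound⇒χla-bound : ∀ {k} → (∀ m (c : Fin n → Fin m) → ProperColoring G m c → k ≤ m) →
    ∀ q (f : EdgeLabeling G q) → IsLocalAntimagic f → k ≤ numColors f
  χ-bound⇒χla-bound bound q f = bound _ _ ∘ localAntimagic⇒proper {f = f}

C₈ : Graph 8
C₈ = circulant 8 (1 ∷ 2 ∷ 3 ∷ [])

first4 : Fin 4 → Fin 8
first4 a = a ↑ˡ 4

C₈-clique : IsClique {G = C₈} first4
C₈-clique = from-yes (all? λ a → all? λ b →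
  (a <? b) →-dec (first4 a <? first4 b) ×-dec (adj C₈ (first4 a) (first4 b) Bool.≟ true))

χ-lower : ∀ m (c : Fin 8 → Fin m) → ProperColoring C₈ m c → 4 ≤ m
χ-lower _ _ = clique⇒χ-bound {vs = first4} C₈-clique

mod4 : Fin 8 → Fin 4
mod4 i = toℕ i mod 4

mod4-proper : ProperColoring C₈ 4 mod4
mod4-proper = edgewise⇒∀ (from-yes (edgewise? C₈ λ i j → ¬? (mod4 i ≟ᶠ mod4 j)))

-- The labels minus one (`label` adds the one back); the last clause only covers non-edges.
labelCode : Fin 8 → Fin 8 → Fin 24
labelCode 0F 1F = # 0
labelCode 0F 2F = # 12
labelCode 0F 3F = # 23
labelCode 0F 5F = # 1
labelCode 0F 6F = # 20
labelCode 0F 7F = # 7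
labelCode 1F 2F = # 19
labelCode 1F 3F = # 17
labelCode 1F 4F = # 8
labelCode 1F 6F = # 18
labelCode 1F 7F = # 4
labelCode 2F 3F = # 13
labelCode 2F 4F = # 2
labelCode 2F 5F = # 11
labelCode 2F 7F = # 15
labelCode 3F 4F = # 10
labelCode 3F 5F = # 3
labelCode 3F 6F = # 9
labelCode 4F 5F = # 16
labelCode 4F 6F = # 5
labelCode 4F 7F = # 22
labelCode 5F 6F = # 14
labelCode 5F 7F = # 21
labelCode 6F 7F = # 6
labelCode _ _ = # 0

labeling : EdgeLabeling C₈ 24
labeling = edgeBijection labelCode
  (from-yes (edgewise? C₈ λ i j → edgewise? C₈ λ i′ j′ →
    (labelCode i j ≟ᶠ labelCode i′ j′) →-dec ≡-dec _≟ᶠ_ _≟ᶠ_ (i , j) (i′ , j′)))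
  (from-yes (all? λ k → someEdge? C₈ λ i j → labelCode i j ≟ᶠ k))

labeling-numColors : numColors labeling ≡ 4
labeling-numColors = refl

labeling-antimagic : IsLocalAntimagic labeling
labeling-antimagic = edgewise⇒∀
  (from-yes (edgewise? C₈ λ i j → ¬? (vertexSum labeling i ℕ.≟ vertexSum labeling j)))

theorem2p7 : IsLocalAntimagicChromaticNumber (circulant 8 (1 ∷ 2 ∷ 3 ∷ [])) 4 × IsChromaticNumber (circulant 8 (1 ∷ 2 ∷ 3 ∷ [])) 4
theorem2p7 =
  ((24 , labeling , labeling-antimagic , labeling-numColors) , χ-bound⇒χla-bound χ-lower) ,
  ((mod4 , mod4-proper) , χ-lower)
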